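{- (Chop Lemma – Top.) Let $r$ and $c$ be typical sequences of length $m\ge3$ and $n\ge3$, respectively, and let $M$ be their merge matrix. Suppose $r(1)=\min(r)$ and $c(1)=\min(c)$. Let $M_1=M[3..m,1..n]$ and $M_2=M[1..m,3..n]$, and for $h\in[2]$ let $p_h$ be a path in $M_h$ dominating every path in $M_h$. Let $p_1^+=(1,1),(2,1)\circ p_1$ and $p_2^+=(1,1),(1,2)\circ p_2$. (1) If $M[3,2]\le M[2,3]$, then $p_1^+$ dominates every path in $M$. (2) If $M[2,3]\le M[3,2]$, then $p_2^+$ dominates every path in $M$.
   Context: A typical sequence is an integer sequence $s$ equal to its own typical sequence $\tau(s)$, where $\tau(s)$ is obtained by exhaustively applying: (1) if $s(i)=s(i+1)$, delete $s(i+1)$; (2) if there are $i,j$ with $j-i\ge2$ such that $s(i)\le s(k)\le s(j)$ for all $i\le k\le j$ or $s(i)\ge s(k)\ge s(j)$ for all $i\le k\le j$, delete the elements strictly between positions $i$ and $j$. The merge matrix of $r$ and $c$ is the $m\times n$ matrix with $M[i,j]=r(i)+c(j)$; $M[a..b,c..d]$ denotes the submatrix on rows $a..b$, columns $c..d$, whose indices are identified with those of $M$. A path in a matrix is a sequence of indices starting at its first-row-first-column index and ending at its last-row-last-column index where each step goes from $(i,j)$ to one of $(i+1,j),(i,j+1),(i+1,j+1)$; $M[p]$ is the sequence of entries along $p$. A path $p$ dominates a path $q$ if $M[p]$ dominates $M[q]$, where for integer sequences $a$ dominates $b$ if there are extensions $a^*$ of $a$ and $b^*$ of $b$ of equal length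 with $a^*(k)\le b^*(k)$ for all $k$; an extension is obtained by repeating each element one or more times consecutively, preserving order. -}

module Defs where

open import Data.Nat as ℕ using (ℕ; zero; suc)
open import Data.Integer as ℤ using (ℤ)
open import Data.Product using (Σ; ∃; ∃-syntax; _×_; _,_)
open import Data.Sum using (_⊎_)
open import Data.List using (List; []; _∷_; map; concat; zipWith; replicate; length)
open import Data.List.Relation.Unary.All using (All)
open import Data.List.Relation.Binary.Pointwise using (Pointwise)
open import Relation.Binary.PropositionalEquality using (_≡_)
open import Relation.Nullary using (¬_)

-- Sequences of length m are functions ℕ → ℤ, read with 1-based indices 1..m
-- (values outside 1..m are irrelevant).

Rule1Applies : ℕ → (ℕ → ℤ) → Set
Rule1Applies m s = ∃[ i ] (1 ℕ.≤ i × suc i ℕ.≤ m × s i ≡ s (suc i))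

Rule2Applies : ℕ → (ℕ → ℤ) → Set
Rule2Applies m s = ∃[ i ] ∃[ j ] (1 ℕ.≤ i × 2 ℕ.+ i ℕ.≤ j × j ℕ.≤ m ×
  ((∀ k → i ℕ.≤ k → k ℕ.≤ j → s i ℤ.≤ s k × s k ℤ.≤ s j)
   ⊎ (∀ k → i ℕ.≤ k → k ℕ.≤ j → s j ℤ.≤ s k × s k ℤ.≤ s i)))

-- s is typical (s = τ(s)) iff neither reduction rule is applicable
-- (each application deletes at least one element).
Typical : ℕ → (ℕ → ℤ) → Set
Typical m s = ¬ Rule1Applies m s × ¬ Rule2Applies m s

FirstIsMin : ℕ → (ℕ → ℤ) → Set
FirstIsMin m s = ∀ i → 1 ℕ.≤ i → i ℕ.≤ m → s 1 ℤ.≤ s i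

merge : (ℕ → ℤ) → (ℕ → ℤ) → ℕ → ℕ → ℤ
merge r c i j = r i ℤ.+ c j

data PathFrom : ℕ × ℕ → ℕ × ℕ → List (ℕ × ℕ) → Set where
  stop  : ∀ {x} → PathFrom x x (x ∷ [])
  down  : ∀ {i j e p} → PathFrom (suc i , j) e p → PathFrom (i , j) e ((i , j) ∷ p)
  right : ∀ {i j e p} → PathFrom (i , suc j) e p → PathFrom (i , j) e ((i , j) ∷ p)
  diag  : ∀ {i j e p} → PathFrom (suc i , suc j) e p → PathFrom (i , j) e ((i , j) ∷ p)

-- p is a path in the submatrix M[a..b, c..d] (indices identified with M's).
PathIn : ℕ → ℕ → ℕ → ℕ → List (ℕ × ℕ) → Set
PathIn a b c d p = PathFrom (a , c) (b , d) p

entries : (ℕ → ℕ → ℤ) → List (ℕ × ℕ) → List ℤ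
entries M p = map (λ { (i , j) → M i j }) p

Extension : List ℤ → List ℤ → Set
Extension a a* = ∃[ ks ] (length ks ≡ length a × All (1 ℕ.≤_) ks ×
  a* ≡ concat (zipWith replicate ks a))

SeqDominates : List ℤ → List ℤ → Set
SeqDominates a b = ∃[ a* ] ∃[ b* ] (Extension a a* × Extension b b* × Pointwise ℤ._≤_ a* b*)

Dominates : (ℕ → ℕ → ℤ) → List (ℕ × ℕ) → List (ℕ × ℕ) → Set
Dominates M p q = SeqDominates (entries M p) (entries M q)

{-# OPTIONS --safe #-}
module Submission where

open import Defs
open import Data.Nat using (ℕ; _≤_)
open import Data.Integer using (ℤ) renaming (_≤_ to _≤ᶻ_)
open import Data.Product using (_×_; _,_)
open import Data.List using (List; _∷_)

open import Level using (Level)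
open import Data.Nat using (suc; z≤n; s≤s; _<_; _≤′_; ≤′-refl; ≤′-step)
open import Data.Nat.Properties
  using (≤-refl; ≤-trans; ≤-antisym; <⇒≤; <⇒≱; n≤1+n; m≤n⇒m≤1+n; m≤n⇒m<n∨m≡n; m<1+n⇒m≤n;
         ≤⇒≤′; ≤′⇒≤; suc-injective)
import Data.Integer.Properties as ℤ
open import Data.Product using (∃-syntax; swap)
open import Data.Sum using (_⊎_; inj₁; inj₂; [_,_]′; map₁)
open import Data.List using ([]; _++_; map; replicate)
open import Data.List.Properties using (map-∘; map-cong)
open import Data.List.Relation.Unary.All using ([]; _∷_)
open import Data.List.Relation.Binary.Pointwise using (Pointwise; []; _∷_)
open import Data.Empty using (⊥-elim)
open import Relation.Nullary using (¬_)
open import Relation.Binary.Bundles using (TotalPreorder)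
import Relation.Binary.Construct.Flip.EqAndOrd as Flip
open import Relation.Binary.PropositionalEquality using (_≡_; refl; sym; trans; cong; subst₂)

-- Since r(1) is the minimum, a typical r of length ≥ 3 has its maximum at
-- position 2: a larger value at some j ≥ 3 would let rule (2) delete
-- everything strictly between 1 and j.  Symmetrically, among positions ≥ 2
-- its minimum sits at position 3.  The same holds for c.  So in M the first
-- column is minimal in every row, row 3 lies below row 2, and when
-- M[3,2] ≤ M[2,3] every entry M[3,i] left of column k lies below M[2,k].
-- Any path q from (1,1) is then dominated by M[1,1], M[2,1] followed by a
-- path from (3,1): M[1,1] is matched against q's stretch in row 1, M[2,1]
-- against its first entry in row 2, and its stretch in row 2 is pushed down
-- into row 3 and continued leftwards to column 1.  Part (2) is part (1) for
-- the transposed matrix, which is the merge matrix of c and r.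

private
  variable
    x y : ℤ
    as bs a* b* xs : List ℤ

-- as ≼ bs is domination read as a monotone staircase through pairs of
-- positions: at each step both sequences advance, or only one of them does
-- while the other repeats its current element.
infix 4 _≼_
data _≼_ : List ℤ → List ℤ → Set where
  []   : [] ≼ []
  adv  : x ≤ᶻ y → as ≼ bs → x ∷ as ≼ y ∷ bs
  advˡ : x ≤ᶻ y → as ≼ y ∷ bs → x ∷ as ≼ y ∷ bs
  advʳ : x ≤ᶻ y → x ∷ as ≼ bs → x ∷ as ≼ y ∷ bs

≼-refl : ∀ as → as ≼ as
≼-refl []       = []
≼-refl (x ∷ as) = adv ℤ.≤-refl (≼-refl as)

≼-trans : ∀ {as bs cs} → as ≼ bs → bs ≼ cs → as ≼ cs
≼-trans []             []               = []
≼-trans (adv x≤y d)    (adv y≤z e)      = adv (ℤ.≤-trans x≤y y≤z) (≼-trans d e)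
≼-trans (adv x≤y d)    (advˡ y≤z e)     = advˡ (ℤ.≤-trans x≤y y≤z) (≼-trans d e)
≼-trans (advʳ x≤y d)   (adv y≤z e)      = advʳ (ℤ.≤-trans x≤y y≤z) (≼-trans d e)
≼-trans (advʳ _ d)     (advˡ _ e)       = ≼-trans d e
≼-trans (advˡ x≤y d)   e@(adv y≤z _)    = advˡ (ℤ.≤-trans x≤y y≤z) (≼-trans d e)
≼-trans (advˡ x≤y d)   e@(advˡ y≤z _)   = advˡ (ℤ.≤-trans x≤y y≤z) (≼-trans d e)
≼-trans (advˡ x≤y d)   e@(advʳ y≤z _)   = advˡ (ℤ.≤-trans x≤y y≤z) (≼-trans d e)
≼-trans d@(adv x≤y _)  (advʳ y≤z e)     = advʳ (ℤ.≤-trans x≤y y≤z) (≼-trans d e)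
≼-trans d@(advʳ x≤y _) (advʳ y≤z e)     = advʳ (ℤ.≤-trans x≤y y≤z) (≼-trans d e)

data Stretch : List ℤ → List ℤ → Set where
  []     : Stretch [] []
  new    : Stretch as xs → Stretch (x ∷ as) (x ∷ xs)
  repeat : Stretch (x ∷ as) xs → Stretch (x ∷ as) (x ∷ xs)

stretch⇒extension : Stretch as xs → Extension as xs
stretch⇒extension []                 = [] , refl , [] , refl
stretch⇒extension {x ∷ _} (new s)    =
  let ks , len , ks≥1 , eq = stretch⇒extension s
  in 1 ∷ ks , cong suc len , s≤s z≤n ∷ ks≥1 , cong (x ∷_) eq
stretch⇒extension {x ∷ _} (repeat s) with stretch⇒extension s
... | k ∷ ks , len , _ ∷ ks≥1 , eq = suc k ∷ ks , len , s≤s z≤n ∷ ks≥1 , cong (x ∷_) eq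

replicate-stretch : ∀ k → Stretch as xs → Stretch (x ∷ as) (replicate (suc k) x ++ xs)
replicate-stretch 0       s = new s
replicate-stretch (suc k) s = repeat (replicate-stretch k s)

extension⇒stretch : Extension as xs → Stretch as xs
extension⇒stretch {[]}    ([] , _ , _ , refl)                 = []
extension⇒stretch {_ ∷ _} (suc k ∷ ks , len , _ ∷ ks≥1 , refl) =
  replicate-stretch k (extension⇒stretch (ks , suc-injective len , ks≥1 , refl))

≼⇒stretches : as ≼ bs → ∃[ a* ] ∃[ b* ] (Stretch as a* × Stretch bs b* × Pointwise _≤ᶻ_ a* b*)
≼⇒stretches []           = [] , [] , [] , [] , []
≼⇒stretches (adv x≤y d)  = let _ , _ , sa , sb , pw = ≼⇒stretches d
                           in _ , _ , new sa , new sb , x≤y ∷ pw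
≼⇒stretches (advˡ x≤y d) = let _ , _ , sa , sb , pw = ≼⇒stretches d
                           in _ , _ , new sa , repeat sb , x≤y ∷ pw
≼⇒stretches (advʳ x≤y d) = let _ , _ , sa , sb , pw = ≼⇒stretches d
                           in _ , _ , repeat sa , new sb , x≤y ∷ pw

stretches⇒≼ : Stretch as a* → Stretch bs b* → Pointwise _≤ᶻ_ a* b* → as ≼ bs
stretches⇒≼ []          []          []         = []
stretches⇒≼ (new sa)    (new sb)    (x≤y ∷ pw) = adv x≤y (stretches⇒≼ sa sb pw)
stretches⇒≼ (new sa)    (repeat sb) (x≤y ∷ pw) = advˡ x≤y (stretches⇒≼ sa sb pw)
stretches⇒≼ (repeat sa) (new sb)    (x≤y ∷ pw) = advʳ x≤y (stretches⇒≼ sa sb pw)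
stretches⇒≼ (repeat sa) (repeat sb) (_ ∷ pw)   = stretches⇒≼ sa sb pw

≼⇒seqDominates : as ≼ bs → SeqDominates as bs
≼⇒seqDominates d =
  let a* , b* , sa , sb , pw = ≼⇒stretches d
  in a* , b* , stretch⇒extension sa , stretch⇒extension sb , pw

seqDominates⇒≼ : SeqDominates as bs → as ≼ bs
seqDominates⇒≼ (_ , _ , ea , eb , pw) =
  stretches⇒≼ (extension⇒stretch ea) (extension⇒stretch eb) pw

pathFrom-head : ∀ {s e p} → PathFrom s e p → ∃[ tl ] p ≡ s ∷ tl
pathFrom-head stop      = _ , refl
pathFrom-head (down _)  = _ , refl
pathFrom-head (right _) = _ , refl
pathFrom-head (diag _)  = _ , refl

pathFrom-≤ : ∀ {i j a b p} → PathFrom (i , j) (a , b) p → i ≤ a × j ≤ b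
pathFrom-≤ stop      = ≤-refl , ≤-refl
pathFrom-≤ (down t)  = let i≤a , j≤b = pathFrom-≤ t in ≤-trans (n≤1+n _) i≤a , j≤b
pathFrom-≤ (right t) = let i≤a , j≤b = pathFrom-≤ t in i≤a , ≤-trans (n≤1+n _) j≤b
pathFrom-≤ (diag t)  = let i≤a , j≤b = pathFrom-≤ t
                       in ≤-trans (n≤1+n _) i≤a , ≤-trans (n≤1+n _) j≤b

pathFrom-swap : ∀ {s e p} → PathFrom s e p → PathFrom (swap s) (swap e) (map swap p)
pathFrom-swap stop      = stop
pathFrom-swap (down t)  = right (pathFrom-swap t)
pathFrom-swap (right t) = down (pathFrom-swap t)
pathFrom-swap (diag t)  = diag (pathFrom-swap t)

entries-merge-swap : ∀ r c p → entries (merge c r) (map swap p) ≡ entries (merge r c) p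
entries-merge-swap r c p = trans (sym (map-∘ p)) (map-cong (λ (i , j) → ℤ.+-comm (c j) (r i)) p)

≤-suc-cases : ∀ {k n} → k ≤ suc n → k ≤ n ⊎ k ≡ suc n
≤-suc-cases k≤1+n = map₁ m<1+n⇒m≤n (m≤n⇒m<n∨m≡n k≤1+n)

module _ {a ℓ₁ ℓ₂ : Level} (T : TotalPreorder a ℓ₁ ℓ₂) where
  open TotalPreorder T using (Carrier; _≲_; total) renaming (refl to ≲-refl; trans to ≲-trans)

  interval-argmax : (s : ℕ → Carrier) {lo hi : ℕ} → lo ≤′ hi →
    ∃[ j ] (lo ≤ j × j ≤ hi × ∀ k → lo ≤ k → k ≤ hi → s k ≲ s j)
  interval-argmax s ≤′-refl = _ , ≤-refl , ≤-refl , at-lo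
    where
    at-lo : ∀ {lo} k → lo ≤ k → k ≤ lo → s k ≲ s lo
    at-lo k lo≤k k≤lo with ≤-antisym k≤lo lo≤k
    ... | refl = ≲-refl
  interval-argmax s {lo} (≤′-step {hi} lo≤′hi) with interval-argmax s lo≤′hi
  ... | j , lo≤j , j≤hi , below-j with total (s j) (s (suc hi))
  ... | inj₁ sj≲ = suc hi , ≤-trans (≤′⇒≤ lo≤′hi) (n≤1+n hi) , ≤-refl ,
        λ k lo≤k k≤1+hi → [ (λ k≤hi → ≲-trans (below-j k lo≤k k≤hi) sj≲)
                            , (λ { refl → ≲-refl }) ]′ (≤-suc-cases k≤1+hi)
  ... | inj₂ ≲sj = j , lo≤j , m≤n⇒m≤1+n j≤hi ,
        λ k lo≤k k≤1+hi → [ below-j k lo≤k , (λ { refl → ≲sj }) ]′ (≤-suc-cases k≤1+hi)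

second-is-max : ∀ {n s} → 2 ≤ n → ¬ Rule2Applies n s → FirstIsMin n s →
  ∀ k → 1 ≤ k → k ≤ n → s k ≤ᶻ s 2
second-is-max {suc n₁} {s} 2≤n ¬rule₂ first-min k 1≤k k≤n
  with interval-argmax ℤ.≤-totalPreorder s (≤⇒≤′ {1} {suc n₁} (s≤s z≤n))
... | 1 , _ , _ , max = ℤ.≤-trans (max k 1≤k k≤n) (first-min 2 (s≤s z≤n) 2≤n)
... | 2 , _ , _ , max = max k 1≤k k≤n
... | suc (suc (suc j)) , _ , j≤n , max =
  ⊥-elim (¬rule₂ (1 , suc (suc (suc j)) , ≤-refl , s≤s (s≤s (s≤s z≤n)) , j≤n ,
    inj₁ λ i 1≤i i≤j → first-min i 1≤i (≤-trans i≤j j≤n) , max i 1≤i (≤-trans i≤j j≤n)))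

third-is-min : ∀ {n s} → 3 ≤ n → ¬ Rule2Applies n s → FirstIsMin n s →
  ∀ k → 2 ≤ k → k ≤ n → s 3 ≤ᶻ s k
third-is-min {1} (s≤s ())
third-is-min {suc (suc n₂)} {s} 3≤n ¬rule₂ first-min k 2≤k k≤n
  with second-is-max (≤-trans (n≤1+n 2) 3≤n) ¬rule₂ first-min
     | interval-argmax (Flip.totalPreorder ℤ.≤-totalPreorder) s
         (≤⇒≤′ {2} {suc (suc n₂)} (s≤s (s≤s z≤n)))
... | _   | 1 , s≤s () , _
... | max | 2 , _ , _ , min = ℤ.≤-trans (max 3 (s≤s z≤n) 3≤n) (min k 2≤k k≤n)
... | _   | 3 , _ , _ , min = min k 2≤k k≤n
... | max | suc (suc (suc (suc j))) , _ , j≤n , min =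
  ⊥-elim (¬rule₂ (2 , suc (suc (suc (suc j))) , s≤s z≤n , s≤s (s≤s (s≤s (s≤s z≤n))) , j≤n ,
    inj₂ λ i 2≤i i≤j → min i 2≤i (≤-trans i≤j j≤n) ,
                       max i (≤-trans (s≤s z≤n) 2≤i) (≤-trans i≤j j≤n)))

module ChopRows (M : ℕ → ℕ → ℤ) {m n : ℕ} (3≤m : 3 ≤ m)
  (first-column-min : ∀ i k → 1 ≤ k → k ≤ n → M i 1 ≤ᶻ M i k)
  (row₃≤row₂ : ∀ k → M 3 k ≤ᶻ M 2 k)
  (row₃≤row₂-right : ∀ i k → 1 ≤ i → i < k → k ≤ n → M 3 i ≤ᶻ M 2 k)
  where

  Path : ℕ → ℕ → List (ℕ × ℕ) → Set
  Path i k = PathFrom (i , k) (m , n)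

  E : List (ℕ × ℕ) → List ℤ
  E = entries M

  column≤n : ∀ {i k t} → Path i k t → k ≤ n
  column≤n t = let _ , k≤n = pathFrom-≤ t in k≤n

  -- In the 'stop' clauses below m has been unified with the current row (< 3).
  row₂-to-row₃ : ∀ {k t} → Path 2 k t → ∃[ w ] (Path 3 k w × E w ≼ E t)
  row₂-to-row₃ stop          = ⊥-elim (<⇒≱ ≤-refl 3≤m)
  row₂-to-row₃ {k} (right t) = let w , pw , w≼t = row₂-to-row₃ t
                               in _ , right pw , adv (row₃≤row₂ k) w≼t
  row₂-to-row₃ {k} (down t) with pathFrom-head t
  ... | _ , refl             = _ , t , advʳ (row₃≤row₂ k) (≼-refl _)
  row₂-to-row₃ {k} (diag t)  = _ , right t , adv (row₃≤row₂ k) (≼-refl _)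

  extend-left : ∀ j {w y ys} → Path 3 (suc j) w → E w ≼ y ∷ ys →
    (∀ i → 1 ≤ i → i ≤ j → M 3 i ≤ᶻ y) → ∃[ q ] (Path 3 1 q × E q ≼ y ∷ ys)
  extend-left 0       pw w≼ _     = _ , pw , w≼
  extend-left (suc j) pw w≼ below =
    extend-left j (right pw) (advˡ (below (suc j) (s≤s z≤n) ≤-refl) w≼)
      (λ i 1≤i i≤j → below i 1≤i (m≤n⇒m≤1+n i≤j))

  from-row₂ : ∀ {k t} → 1 ≤ k → Path 2 k t → ∃[ q ] (Path 3 1 q × M 2 1 ∷ E q ≼ E t)
  from-row₂ {suc j} 1≤k t with pathFrom-head t
  ... | _ , refl =
    let w , pw , w≼t = row₂-to-row₃ t
        q , pq , q≼t = extend-left j pw w≼t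
                         (λ i 1≤i i≤j → row₃≤row₂-right i (suc j) 1≤i (s≤s i≤j) (column≤n t))
    in q , pq , advˡ (first-column-min 2 (suc j) 1≤k (column≤n t)) q≼t

  from-row₁ : ∀ {k t} → 1 ≤ k → Path 1 k t → ∃[ q ] (Path 3 1 q × M 1 1 ∷ M 2 1 ∷ E q ≼ E t)
  from-row₁ 1≤k stop = ⊥-elim (<⇒≱ (s≤s (s≤s z≤n)) 3≤m)
  from-row₁ {k} 1≤k t@(right t′) =
    let q , pq , q≼t′ = from-row₁ (m≤n⇒m≤1+n 1≤k) t′
    in q , pq , advʳ (first-column-min 1 k 1≤k (column≤n t)) q≼t′
  from-row₁ {k} 1≤k t@(down t′) =
    let q , pq , q≼t′ = from-row₂ 1≤k t′
    in q , pq , adv (first-column-min 1 k 1≤k (column≤n t)) q≼t′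
  from-row₁ {k} 1≤k t@(diag t′) =
    let q , pq , q≼t′ = from-row₂ (s≤s z≤n) t′
    in q , pq , adv (first-column-min 1 k 1≤k (column≤n t)) q≼t′

  chop-dominates : ∀ p → (∀ q → Path 3 1 q → E p ≼ E q) →
    ∀ q → Path 1 1 q → M 1 1 ∷ M 2 1 ∷ E p ≼ E q
  chop-dominates p p-dominates q pq =
    let q′ , pq′ , q′≼q = from-row₁ (s≤s z≤n) pq
    in ≼-trans (adv ℤ.≤-refl (adv ℤ.≤-refl (p-dominates q′ pq′))) q′≼q

chop-rows : ∀ m n (r c : ℕ → ℤ) → 3 ≤ m → 3 ≤ n → ¬ Rule2Applies m r → ¬ Rule2Applies n c →
  FirstIsMin m r → FirstIsMin n c → merge r c 3 2 ≤ᶻ merge r c 2 3 →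
  (p : List (ℕ × ℕ)) → (∀ q → PathIn 3 m 1 n q → Dominates (merge r c) p q) →
  ∀ q → PathIn 1 m 1 n q → Dominates (merge r c) ((1 , 1) ∷ (2 , 1) ∷ p) q
chop-rows m n r c 3≤m 3≤n ¬rule₂-r ¬rule₂-c r-min c-min corner p p-dominates q pq =
  ≼⇒seqDominates (chop-dominates p (λ q′ pq′ → seqDominates⇒≼ (p-dominates q′ pq′)) q pq)
  where
  open ℤ.≤-Reasoning

  right-of-corner : ∀ i k → 1 ≤ i → i < k → k ≤ n → merge r c 3 i ≤ᶻ merge r c 2 k
  right-of-corner i k 1≤i i<k k≤n = begin
    merge r c 3 i ≤⟨ ℤ.+-monoʳ-≤ (r 3) (second-is-max (≤-trans (n≤1+n 2) 3≤n) ¬rule₂-c c-min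
                                          i 1≤i (≤-trans (<⇒≤ i<k) k≤n)) ⟩
    merge r c 3 2 ≤⟨ corner ⟩
    merge r c 2 3 ≤⟨ ℤ.+-monoʳ-≤ (r 2) (third-is-min 3≤n ¬rule₂-c c-min
                                          k (≤-trans (s≤s 1≤i) i<k) k≤n) ⟩
    merge r c 2 k ∎

  r₃≤r₂ : r 3 ≤ᶻ r 2
  r₃≤r₂ = second-is-max (≤-trans (n≤1+n 2) 3≤m) ¬rule₂-r r-min 3 (s≤s z≤n) 3≤m

  open ChopRows (merge r c) 3≤m (λ i k 1≤k k≤n → ℤ.+-monoʳ-≤ (r i) (c-min k 1≤k k≤n))
    (λ k → ℤ.+-monoˡ-≤ (c k) r₃≤r₂) right-of-corner

chop-columns : ∀ m n (r c : ℕ → ℤ) → 3 ≤ m → 3 ≤ n → ¬ Rule2Applies m r → ¬ Rule2Applies n c →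
  FirstIsMin m r → FirstIsMin n c → merge r c 2 3 ≤ᶻ merge r c 3 2 →
  (p : List (ℕ × ℕ)) → (∀ q → PathIn 1 m 3 n q → Dominates (merge r c) p q) →
  ∀ q → PathIn 1 m 1 n q → Dominates (merge r c) ((1 , 1) ∷ (1 , 2) ∷ p) q
chop-columns m n r c 3≤m 3≤n ¬rule₂-r ¬rule₂-c r-min c-min corner p p-dominates q pq =
  subst₂ SeqDominates (entries-merge-swap r c ((1 , 1) ∷ (1 , 2) ∷ p)) (entries-merge-swap r c q)
    (chop-rows n m c r 3≤n 3≤m ¬rule₂-c ¬rule₂-r c-min r-min
      (subst₂ _≤ᶻ_ (ℤ.+-comm (r 2) (c 3)) (ℤ.+-comm (r 3) (c 2)) corner)
      (map swap p) swapped-dominates (map swap q) (pathFrom-swap pq))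
  where
  swapped-dominates : ∀ q′ → PathIn 3 n 1 m q′ → Dominates (merge c r) (map swap p) q′
  swapped-dominates q′ pq′ =
    subst₂ SeqDominates (sym (entries-merge-swap r c p)) (entries-merge-swap c r q′)
      (p-dominates (map swap q′) (pathFrom-swap pq′))

corollary3p12 : (m n : ℕ) (r c : ℕ → ℤ) →
    3 ≤ m → 3 ≤ n → Typical m r → Typical n c →
    FirstIsMin m r → FirstIsMin n c →
    (p₁ : List (ℕ × ℕ)) → PathIn 3 m 1 n p₁ →
    (∀ q → PathIn 3 m 1 n q → Dominates (merge r c) p₁ q) →
    (p₂ : List (ℕ × ℕ)) → PathIn 1 m 3 n p₂ →
    (∀ q → PathIn 1 m 3 n q → Dominates (merge r c) p₂ q) →
    (merge r c 3 2 ≤ᶻ merge r c 2 3 →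
      ∀ q → PathIn 1 m 1 n q → Dominates (merge r c) ((1 , 1) ∷ (2 , 1) ∷ p₁) q)
    × (merge r c 2 3 ≤ᶻ merge r c 3 2 →
      ∀ q → PathIn 1 m 1 n q → Dominates (merge r c) ((1 , 1) ∷ (1 , 2) ∷ p₂) q)
corollary3p12 m n r c 3≤m 3≤n (_ , ¬rule₂-r) (_ , ¬rule₂-c) r-min c-min
              p₁ _ p₁-dominates p₂ _ p₂-dominates =
  (λ corner → chop-rows m n r c 3≤m 3≤n ¬rule₂-r ¬rule₂-c r-min c-min corner p₁ p₁-dominates) ,
  (λ corner → chop-columns m n r c 3≤m 3≤n ¬rule₂-r ¬rule₂-c r-min c-min corner p₂ p₂-dominates)
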